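{- Let $G$ be a $2$-connected graph of order $n\geq 4$, and let $u,v$ be two adjacent vertices of $G$ with $d_G(u)=d_G(v)=2$. Then $rvd(G)\leq rvd(G/uv)$.
   Context: All graphs are simple, finite and undirected. For a vertex-colored graph $G$, a vertex set $S$ is rainbow if no two vertices of $S$ have the same color. For two vertices $x,y$ of $G$: if $x,y$ are nonadjacent, an $x$-$y$ vertex-cut is a set $S\subseteq V(G)$ (not containing $x,y$) such that $x$ and $y$ lie in different components of $G-S$; if $x,y$ are adjacent, an $x$-$y$ vertex-cut is a set $S\subseteq V(G)$ (not containing $x,y$) such that $x$ and $y$ lie in different components of $(G-xy)-S$. An $x$-$y$ rainbow vertex-cut is an $x$-$y$ vertex-cut $S$ such that $S$ is rainbow when $x,y$ are nonadjacent, and $S\cup\{x\}$ or $S\cup\{y\}$ is rainbow when $x,y$ are adjacent. A vertex-coloring of $G$ is a rainbow vertex-disconnection coloring if for every two vertices $x,y$ of $G$ there is an $x$-$y$ rainbow vertex-cut. For a nontrivial connected graph $G$, $rvd(G)$ is the minimum number of colors in a rainbow vertex-disconnection coloring of $G$. $d_G(w)$ denotes the degree of $w$. $G/uv$ is the (simple) graph obtained from $G$ by contracting the edge $uv$, i.e. deleting the edge and identifying its ends. -}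

module Defs where

open import Data.Nat using (ℕ; zero; suc; _≤_)
open import Data.Fin using (Fin; punchIn)
open import Data.Fin.Properties using (_≟_)
open import Data.Fin.Subset using (Subset; ⊥; _∈_; _∉_; _∪_; ⁅_⁆)
open import Data.List using (List; length; filter)
open import Data.List using () renaming (_∷_ to _∷ₗ_)
open import Data.Fin using (zero; suc)
open import Data.Vec.Functional using ()
open import Data.List.Base using (allFin)
open import Data.Product using (Σ; ∃; _×_; _,_; proj₁; proj₂)
open import Data.Sum using (_⊎_; inj₁; inj₂)
open import Relation.Nullary using (¬_; Dec; yes; no)
open import Relation.Nullary.Decidable using (_×-dec_; _⊎-dec_; ¬?)
open import Relation.Binary.PropositionalEquality using (_≡_; _≢_; refl; sym)

record Graph (n : ℕ) : Set₁ where
  field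
    Adj    : Fin n → Fin n → Set
    adj?   : ∀ x y → Dec (Adj x y)
    adj-sym    : ∀ {x y} → Adj x y → Adj y x
    adj-irrefl : ∀ {x} → ¬ Adj x x
open Graph public

degree : ∀ {n} → Graph n → Fin n → ℕ
degree G w = length (filter (adj? G w) (allFin _))

-- Walks in a relation R whose vertices (after the first) avoid S.

data Reach {n : ℕ} (R : Fin n → Fin n → Set) (S : Subset n) : Fin n → Fin n → Set where
  here : ∀ {x} → Reach R S x x
  step : ∀ {x y z} → R x y → y ∉ S → Reach R S y z → Reach R S x z

DelEdge : ∀ {n} → Graph n → Fin n → Fin n → Fin n → Fin n → Set
DelEdge G x y a b = Adj G a b × ¬ (a ≡ x × b ≡ y) × ¬ (a ≡ y × b ≡ x)

∅' : ∀ {n} → Subset n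
∅' = ⊥

ConnectedAvoiding : ∀ {n} → Graph n → Subset n → Set
ConnectedAvoiding G S = ∀ x y → x ∉ S → y ∉ S → Reach (Adj G) S x y

Connected : ∀ {n} → Graph n → Set
Connected G = ConnectedAvoiding G ∅'

TwoConnected : ∀ {n} → Graph n → Set
TwoConnected {n} G = 3 ≤ n × Connected G × (∀ w → ConnectedAvoiding G ⁅ w ⁆)

Rainbow : ∀ {n k} → (Fin n → Fin k) → Subset n → Set
Rainbow c T = ∀ a b → a ∈ T → b ∈ T → c a ≡ c b → a ≡ b

VertexCut : ∀ {n} → Graph n → Fin n → Fin n → Subset n → Set
VertexCut G x y S =
  x ∉ S × y ∉ S ×
  (¬ Adj G x y → ¬ Reach (Adj G) S x y) ×
  (Adj G x y → ¬ Reach (DelEdge G x y) S x y)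

RainbowVertexCut : ∀ {n k} → Graph n → (Fin n → Fin k) → Fin n → Fin n → Subset n → Set
RainbowVertexCut G c x y S =
  VertexCut G x y S ×
  (¬ Adj G x y → Rainbow c S) ×
  (Adj G x y → Rainbow c (S ∪ ⁅ x ⁆) ⊎ Rainbow c (S ∪ ⁅ y ⁆))

IsRVDColoring : ∀ {n k} → Graph n → (Fin n → Fin k) → Set
IsRVDColoring G c = ∀ x y → x ≢ y → ∃ λ S → RainbowVertexCut G c x y S

HasRVD : ∀ {n} → Graph n → ℕ → Set
HasRVD {n} G k = Σ (Fin n → Fin k) λ c → IsRVDColoring G c

RvdIs : ∀ {n} → Graph n → ℕ → Set
RvdIs G k = HasRVD G k × (∀ j → HasRVD G j → k ≤ j)

-- Contraction G/uv on vertex set Fin m (G on Fin (suc m)).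
-- Vertex a of G/uv stands for punchIn v a (all vertices of G except v);
-- the vertex standing for u is the merged vertex.

ContrAdj : ∀ {m} → Graph (suc m) → Fin (suc m) → Fin (suc m) → Fin m → Fin m → Set
ContrAdj G u v a b =
  a ≢ b ×
  (Adj G (punchIn v a) (punchIn v b)
   ⊎ (punchIn v a ≡ u × Adj G v (punchIn v b))
   ⊎ (punchIn v b ≡ u × Adj G (punchIn v a) v))

private
  ≢-sym : ∀ {m} {a b : Fin m} → a ≢ b → b ≢ a
  ≢-sym p q = p (sym q)

contract : ∀ {m} → Graph (suc m) → Fin (suc m) → Fin (suc m) → Graph m
contract G u v = record
  { Adj = ContrAdj G u v
  ; adj? = λ a b → ¬? (a ≟ b) ×-dec
      (adj? G (punchIn v a) (punchIn v b)
       ⊎-dec ((punchIn v a ≟ u) ×-dec adj? G v (punchIn v b))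
       ⊎-dec ((punchIn v b ≟ u) ×-dec adj? G (punchIn v a) v))
  ; adj-sym = λ { (ne , inj₁ e) → ≢-sym ne , inj₁ (adj-sym G e)
            ; (ne , inj₂ (inj₁ (p , e))) → ≢-sym ne , inj₂ (inj₂ (p , adj-sym G e))
            ; (ne , inj₂ (inj₂ (p , e))) → ≢-sym ne , inj₂ (inj₁ (p , adj-sym G e)) }
  ; adj-irrefl = λ { (ne , _) → ne refl }
  }

-- Identifying G - v with G/uv exhibits G as G/uv with the edge from the merged vertex to z
-- subdivided by v; identifying G - u with G/uv instead, as G/uv with the edge to w subdivided by u.
-- A rainbow vertex-disconnection colouring c′ of H gives one of any subdivision G of an edge ab
-- with the same colours: take the rainbow a-b cut X of H and an end e with X ∪ {e} rainbow, and
-- give the new vertex s the colour of e. Cuts of H pull back to cuts of G, because a walk through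
-- s collapses to a walk using the edge ab; a, b and s, a are cut by the preimage of X (with s added
-- for a, b); s is cut from any other y by {a, b} if c′ a ≠ c′ b, and otherwise by the preimage of
-- a cut of H between y and an end not adjacent to y, which exists unless y is adjacent to both.
-- Subdividing at v therefore works unless c′ gives the merged vertex the colour of z; then
-- subdividing at u works, because the merged vertex, w and z would otherwise form a monochromatic
-- triangle, which no such colouring has. Two-connectivity and n ≥ 4 only serve to make w ≠ z.

module Submission where

open import Defs
open import Data.Nat using (ℕ; suc; _≤_)
open import Data.Fin using (Fin)
open import Relation.Binary.PropositionalEquality using (_≡_)

open import Data.Empty using (⊥; ⊥-elim)
open import Data.Fin using (zero; suc; punchIn; punchOut; inject≤)
open import Data.Fin.Properties
  using (_≟_; any?; pigeonhole; <⇒≢; inject≤-injective; punchIn-punchOut; punchOut-punchIn;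
         punchOut-cong; punchIn-injective; punchInᵢ≢i)
open import Data.Fin.Subset using (Subset; _∈_; _∉_; _∪_; ⁅_⁆)
open import Data.Fin.Subset.Properties using (_∈?_; x∈⁅x⁆; x∈⁅y⁆⇒x≡y; x∈p∪q⁻; x∈p∪q⁺)
open import Data.List using (List; []; _∷_; length; filter; allFin)
open import Data.List.Membership.Propositional using () renaming (_∈_ to _∈ₗ_)
open import Data.List.Membership.Propositional.Properties using (∈-filter⁺; ∈-filter⁻; ∈-allFin)
open import Data.List.Relation.Unary.All using () renaming (_∷_ to _∷ᵃ_)
open import Data.List.Relation.Unary.AllPairs using () renaming (_∷_ to _∷ᵖ_)
open import Data.List.Relation.Unary.Any using (here; there)
open import Data.List.Relation.Unary.Unique.Propositional using (Unique)
open import Data.List.Relation.Unary.Unique.Propositional.Properties using (filter⁺; allFin⁺)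
open import Data.Nat using (s≤s; z≤n)
open import Data.Product using (∃; ∃₂; _×_; _,_; proj₁; proj₂)
open import Data.Sum as Sum using (_⊎_; inj₁; inj₂)
open import Data.Vec using (tabulate)
open import Data.Vec.Properties using (lookup∘tabulate; []=⇒lookup; lookup⇒[]=)
open import Function using (_∘_)
open import Relation.Nullary using (¬_; Dec; yes; no; does)
open import Relation.Nullary.Decidable using (dec-true; _×-dec_; _⊎-dec_; ¬?)
open import Relation.Unary using (Decidable)
open import Relation.Binary.PropositionalEquality using (_≢_; refl; sym; trans; cong; subst; subst₂)

module _ {n : ℕ} {R : Fin n → Fin n → Set} {S : Subset n} where

  reach-snoc : ∀ {x y z} → Reach R S x y → R y z → z ∉ S → Reach R S x z
  reach-snoc here            r z∉ = step r z∉ here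
  reach-snoc (step r′ y∉ w) r z∉ = step r′ y∉ (reach-snoc w r z∉)

  reach-reverse : (∀ {a b} → R a b → R b a) → ∀ {x y} → x ∉ S → Reach R S x y → Reach R S y x
  reach-reverse sym-R x∉ here          = here
  reach-reverse sym-R x∉ (step r y∉ w) = reach-snoc (reach-reverse sym-R y∉ w) (sym-R r) x∉

  reach-invariant : (P : Fin n → Set) → (∀ {a b} → P a → R a b → b ∉ S → P b) →
                    ∀ {x y} → P x → Reach R S x y → P y
  reach-invariant P pres px here          = px
  reach-invariant P pres px (step r y∉ w) = reach-invariant P pres (pres px r y∉) w

reach-mono : ∀ {n} {R R′ : Fin n → Fin n → Set} {S : Subset n} →
             (∀ {a b} → R a b → R′ a b) → ∀ {x y} → Reach R S x y → Reach R′ S x y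
reach-mono R⊆R′ here          = here
reach-mono R⊆R′ (step r y∉ w) = step (R⊆R′ r) y∉ (reach-mono R⊆R′ w)

SimulatedStep : ∀ {n m} → (Fin m → Fin m → Set) → Subset m → (Fin n → Fin m) → Fin n → Fin n → Set
SimulatedStep R′ S′ f a b = f a ≡ f b ⊎ (R′ (f a) (f b) × f b ∉ S′)

reach-simulate : ∀ {n m} {R : Fin n → Fin n → Set} {R′ : Fin m → Fin m → Set}
                 {S : Subset n} {S′ : Subset m} (f : Fin n → Fin m) →
                 (∀ {a b} → a ∉ S → R a b → b ∉ S → SimulatedStep R′ S′ f a b) →
                 ∀ {x y} → x ∉ S → Reach R S x y → Reach R′ S′ (f x) (f y)
reach-simulate f sim x∉ here = here
reach-simulate f sim x∉ (step r y∉ w) with sim x∉ r y∉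
... | inj₁ fx≡fy rewrite fx≡fy = reach-simulate f sim y∉ w
... | inj₂ (r′ , fy∉) = step r′ fy∉ (reach-simulate f sim y∉ w)

subsetOf : ∀ {n} {P : Fin n → Set} → Decidable P → Subset n
subsetOf P? = tabulate (does ∘ P?)

module _ {n : ℕ} {P : Fin n → Set} (P? : Decidable P) where

  ∈-subsetOf⁺ : ∀ {x} → P x → x ∈ subsetOf P?
  ∈-subsetOf⁺ {x} px = lookup⇒[]= x _ (trans (lookup∘tabulate (does ∘ P?) x) (dec-true (P? x) px))

  ∈-subsetOf⁻ : ∀ {x} → x ∈ subsetOf P? → P x
  ∈-subsetOf⁻ {x} x∈ with P? x | trans (sym (lookup∘tabulate (does ∘ P?) x)) ([]=⇒lookup x∈)
  ... | yes px | _ = px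
  ... | no _   | ()

∉-∪⁻ˡ : ∀ {n} {x : Fin n} {S T : Subset n} → x ∉ S ∪ T → x ∉ S
∉-∪⁻ˡ x∉ x∈ = x∉ (x∈p∪q⁺ (inj₁ x∈))

∉-∪⁻ʳ : ∀ {n} {x : Fin n} {S T : Subset n} → x ∉ S ∪ T → x ∉ T
∉-∪⁻ʳ x∉ x∈ = x∉ (x∈p∪q⁺ (inj₂ x∈))

∈-⁅⁆∪⁅⁆⁻ : ∀ {n} {x a b : Fin n} → x ∈ ⁅ a ⁆ ∪ ⁅ b ⁆ → x ≡ a ⊎ x ≡ b
∈-⁅⁆∪⁅⁆⁻ {a = a} {b} x∈ =
  Sum.map (x∈⁅y⁆⇒x≡y a) (x∈⁅y⁆⇒x≡y b) (x∈p∪q⁻ ⁅ a ⁆ ⁅ b ⁆ x∈)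

∈-⁅⁆∪⁅⁆⁺ : ∀ {n} {x a b : Fin n} → x ≡ a ⊎ x ≡ b → x ∈ ⁅ a ⁆ ∪ ⁅ b ⁆
∈-⁅⁆∪⁅⁆⁺ (inj₁ refl) = x∈p∪q⁺ (inj₁ (x∈⁅x⁆ _))
∈-⁅⁆∪⁅⁆⁺ (inj₂ refl) = x∈p∪q⁺ (inj₂ (x∈⁅x⁆ _))

module _ {n : ℕ} (G : Graph n) where

  delEdge-sym : ∀ {x y a b} → DelEdge G x y a b → DelEdge G x y b a
  delEdge-sym (ab , ¬xy , ¬yx) =
    adj-sym G ab , (λ (b≡x , a≡y) → ¬yx (a≡y , b≡x)) , (λ (b≡y , a≡x) → ¬xy (a≡x , b≡y))

  delEdge-swap : ∀ {x y a b} → DelEdge G x y a b → DelEdge G y x a b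
  delEdge-swap (ab , ¬xy , ¬yx) = ab , ¬yx , ¬xy

  vertexCut-sym : ∀ {x y S} → VertexCut G x y S → VertexCut G y x S
  vertexCut-sym (x∉ , y∉ , sep , sep-adj) =
    y∉ , x∉ ,
    (λ ¬yx w → sep (¬yx ∘ adj-sym G) (reach-reverse (adj-sym G) y∉ w)) ,
    (λ yx w → sep-adj (adj-sym G yx) (reach-reverse delEdge-sym y∉ (reach-mono delEdge-swap w)))

  rainbowVertexCut-sym : ∀ {k} {c : Fin n → Fin k} {x y S} →
                         RainbowVertexCut G c x y S → RainbowVertexCut G c y x S
  rainbowVertexCut-sym (cut , rb , rb-adj) =
    vertexCut-sym cut , (λ ¬yx → rb (¬yx ∘ adj-sym G)) , (λ yx → Sum.swap (rb-adj (adj-sym G yx)))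

rainbow-pullback : ∀ {n m k} (c : Fin m → Fin k) (f : Fin n → Fin m) {T : Subset n} {T′ : Subset m} →
                   (∀ {a} → a ∈ T → f a ∈ T′) → (∀ {a b} → a ∈ T → b ∈ T → f a ≡ f b → a ≡ b) →
                   Rainbow c T′ → Rainbow (c ∘ f) T
rainbow-pullback c f maps-to injective rb a b a∈ b∈ ca≡cb =
  injective a∈ b∈ (rb (f a) (f b) (maps-to a∈) (maps-to b∈) ca≡cb)

rainbow-pair : ∀ {n k} (c : Fin n → Fin k) {a b : Fin n} → c a ≢ c b → Rainbow c (⁅ a ⁆ ∪ ⁅ b ⁆)
rainbow-pair c ca≢cb x y x∈ y∈ cx≡cy with ∈-⁅⁆∪⁅⁆⁻ x∈ | ∈-⁅⁆∪⁅⁆⁻ y∈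
... | inj₁ refl | inj₁ refl = refl
... | inj₂ refl | inj₂ refl = refl
... | inj₁ refl | inj₂ refl = ⊥-elim (ca≢cb cx≡cy)
... | inj₂ refl | inj₁ refl = ⊥-elim (ca≢cb (sym cx≡cy))

rvd-no-monochromatic-triangle : ∀ {n k} (G : Graph n) {c : Fin n → Fin k} → IsRVDColoring G c →
  ∀ {a b d} → Adj G a b → Adj G b d → Adj G a d → c a ≡ c b → c a ≡ c d → ⊥
rvd-no-monochromatic-triangle G {c} rvd {a} {b} {d} ab bd ad ca≡cb ca≡cd = separated (rvd a b a≢b)
  where
  a≢b : a ≢ b
  a≢b refl = adj-irrefl G ab
  d≢a : d ≢ a
  d≢a refl = adj-irrefl G ad
  d≢b : d ≢ b
  d≢b refl = adj-irrefl G bd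

  -- The cut must contain d, or a – d – b survives the deletion of ab; then d shares a colour with a or b.
  separated : ∃ (RainbowVertexCut G c a b) → ⊥
  separated (X , (_ , b∉ , _ , sep-adj) , _ , rb-adj) with d ∈? X | rb-adj ab
  ... | no d∉ | _ =
    sep-adj ab (step (ad , (λ (_ , d≡b) → d≢b d≡b) , λ (_ , d≡a) → d≢a d≡a) d∉
                 (step (adj-sym G bd , (λ (d≡a , _) → d≢a d≡a) , λ (d≡b , _) → d≢b d≡b) b∉ here))
  ... | yes d∈ | inj₁ rb =
    d≢a (rb d a (x∈p∪q⁺ (inj₁ d∈)) (x∈p∪q⁺ (inj₂ (x∈⁅x⁆ a))) (sym ca≡cd))
  ... | yes d∈ | inj₂ rb =
    d≢b (rb d b (x∈p∪q⁺ (inj₁ d∈)) (x∈p∪q⁺ (inj₂ (x∈⁅x⁆ b))) (trans (sym ca≡cd) ca≡cb))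

length-two-other : ∀ {A : Set} {xs : List A} {v : A} → length xs ≡ 2 → Unique xs → v ∈ₗ xs →
  ∃ λ w → w ∈ₗ xs × w ≢ v × (∀ {y} → y ∈ₗ xs → y ≡ v ⊎ y ≡ w)
length-two-other {xs = a ∷ b ∷ []} refl ((a≢b ∷ᵃ _) ∷ᵖ _) (here refl) =
  b , there (here refl) , a≢b ∘ sym ,
  λ { (here y≡a) → inj₁ y≡a ; (there (here y≡b)) → inj₂ y≡b ; (there (there ())) }
length-two-other {xs = a ∷ b ∷ []} refl ((a≢b ∷ᵃ _) ∷ᵖ _) (there (here refl)) =
  a , here refl , a≢b ,
  λ { (here y≡a) → inj₂ y≡a ; (there (here y≡b)) → inj₁ y≡b ; (there (there ())) }

degree-two-neighbours : ∀ {n} (G : Graph n) {u v} → Adj G u v → degree G u ≡ 2 →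
  ∃ λ w → Adj G u w × w ≢ v × (∀ {y} → Adj G u y → y ≡ v ⊎ y ≡ w)
degree-two-neighbours {n} G {u} {v} uv du
  with length-two-other du (filter⁺ (adj? G u) (allFin⁺ n)) (∈-filter⁺ (adj? G u) (∈-allFin v) uv)
... | w , w∈ , w≢v , only =
  w , proj₂ (∈-filter⁻ (adj? G u) {xs = allFin n} w∈) , w≢v ,
  λ uy → only (∈-filter⁺ (adj? G u) (∈-allFin _) uy)

module _ {n : ℕ} (a b c : Fin n) where

  private
    index : Fin n → Fin 3
    index x with x ≟ a | x ≟ b
    ... | yes _ | _     = zero
    ... | no _  | yes _ = suc zero
    ... | no _  | no _  = suc (suc zero)

    member : Fin 3 → Fin n
    member zero             = a
    member (suc zero)       = b
    member (suc (suc zero)) = c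

    member-index : ∀ x → ¬ (x ≢ a × x ≢ b × x ≢ c) → member (index x) ≡ x
    member-index x not-outside with x ≟ a | x ≟ b | x ≟ c
    ... | yes refl | _        | _        = refl
    ... | no _     | yes refl | _        = refl
    ... | no _     | no _     | yes refl = refl
    ... | no x≢a   | no x≢b   | no x≢c   = ⊥-elim (not-outside (x≢a , x≢b , x≢c))

    outside? : Decidable (λ x → x ≢ a × x ≢ b × x ≢ c)
    outside? x = ¬? (x ≟ a) ×-dec ¬? (x ≟ b) ×-dec ¬? (x ≟ c)

  -- Otherwise pigeonhole would identify two of four distinct vertices.
  fourth-vertex : 4 ≤ n → ∃ λ y → y ≢ a × y ≢ b × y ≢ c
  fourth-vertex 4≤n with any? (λ i → outside? (inject≤ i 4≤n))
  ... | yes (i , outside) = inject≤ i 4≤n , outside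
  ... | no none with pigeonhole (s≤s (s≤s (s≤s (s≤s z≤n)))) (λ i → index (inject≤ i 4≤n))
  ...   | i , j , i<j , same =
    ⊥-elim (<⇒≢ i<j (inject≤-injective 4≤n 4≤n i j
      (trans (sym (member-index _ (λ o → none (i , o))))
        (trans (cong member same) (member-index _ (λ o → none (j , o)))))))

-- If w = z, then w separates u and v from any fourth vertex.
pendant-path-ends-distinct : ∀ {n} (G : Graph n) → 4 ≤ n → (∀ x → ConnectedAvoiding G ⁅ x ⁆) →
  ∀ {u v w z} → u ≢ w →
  (∀ {y} → Adj G u y → y ≡ v ⊎ y ≡ w) → (∀ {y} → Adj G v y → y ≡ u ⊎ y ≡ z) → w ≢ z
pendant-path-ends-distinct G 4≤n no-cut-vertex {u} {v} {w} u≢w u-neighbours v-neighbours refl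
  with fourth-vertex u v w 4≤n
... | y , outside@(y≢u , _ , y≢w) =
  proj₁ (reach-invariant Outside stays outside
    (no-cut-vertex w y u (y≢w ∘ x∈⁅y⁆⇒x≡y w) (u≢w ∘ x∈⁅y⁆⇒x≡y w))) refl
  where
  Outside : _ → Set
  Outside a = a ≢ u × a ≢ v × a ≢ w
  stays : ∀ {a b} → Outside a → Adj G a b → b ∉ ⁅ w ⁆ → Outside b
  stays (a≢u , a≢v , a≢w) ab b∉ =
    (λ { refl → Sum.[ a≢v , a≢w ] (u-neighbours (adj-sym G ab)) }) ,
    (λ { refl → Sum.[ a≢u , a≢w ] (v-neighbours (adj-sym G ab)) }) ,
    (λ { refl → b∉ (x∈⁅x⁆ w) })

-- G arises from H by subdividing the edge h t – h p with the new vertex s; h identifies G - s with H.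
record IsEdgeSubdivision {N M : ℕ} (G : Graph N) (H : Graph M) (s t p : Fin N) (h : Fin N → Fin M) : Set where
  field
    h-injective  : ∀ {x y} → x ≢ s → y ≢ s → h x ≡ h y → x ≡ y
    s-adj-t      : Adj G s t
    s-adj-p      : Adj G s p
    s-neighbours : ∀ {y} → Adj G s y → y ≡ t ⊎ y ≡ p
    t-nonadj-p   : ¬ Adj G t p
    h-adj        : ∀ {x y} → x ≢ s → y ≢ s → Adj G x y → Adj H (h x) (h y)
    h-adj⁻       : ∀ {x y} → x ≢ s → y ≢ s → Adj H (h x) (h y) →
                   Adj G x y ⊎ (x ≡ t × y ≡ p) ⊎ (x ≡ p × y ≡ t)
    h-adj-tp     : Adj H (h t) (h p)

isEdgeSubdivision-swap : ∀ {N M} {G : Graph N} {H : Graph M} {s t p h} →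
                         IsEdgeSubdivision G H s t p h → IsEdgeSubdivision G H s p t h
isEdgeSubdivision-swap {G = G} {H} D = record
  { h-injective  = h-injective
  ; s-adj-t      = s-adj-p
  ; s-adj-p      = s-adj-t
  ; s-neighbours = Sum.swap ∘ s-neighbours
  ; t-nonadj-p   = t-nonadj-p ∘ adj-sym G
  ; h-adj        = h-adj
  ; h-adj⁻       = λ x≢s y≢s hxy → Sum.map₂ Sum.swap (h-adj⁻ x≢s y≢s hxy)
  ; h-adj-tp     = adj-sym H h-adj-tp
  }
  where open IsEdgeSubdivision D

module Collapse {N M : ℕ} (s : Fin N) (h : Fin N → Fin M) where

  collapse : Fin M → Fin N → Fin M
  collapse σ x with x ≟ s
  ... | yes _ = σ
  ... | no  _ = h x

  collapse-s : ∀ σ → collapse σ s ≡ σ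
  collapse-s σ with s ≟ s
  ... | yes _   = refl
  ... | no  s≢s = ⊥-elim (s≢s refl)

  collapse-≢s : ∀ σ {x} → x ≢ s → collapse σ x ≡ h x
  collapse-≢s σ {x} x≢s with x ≟ s
  ... | yes x≡s = ⊥-elim (x≢s x≡s)
  ... | no  _   = refl

  preimage? : ∀ S′ → Decidable (λ x → x ≢ s × h x ∈ S′)
  preimage? S′ x = ¬? (x ≟ s) ×-dec (h x ∈? S′)

  preimage : Subset M → Subset N
  preimage S′ = subsetOf (preimage? S′)

  ∈-preimage⁺ : ∀ {S′ x} → x ≢ s → h x ∈ S′ → x ∈ preimage S′
  ∈-preimage⁺ {S′} x≢s hx∈ = ∈-subsetOf⁺ (preimage? S′) (x≢s , hx∈)

  ∈-preimage⁻ : ∀ {S′ x} → x ∈ preimage S′ → x ≢ s × h x ∈ S′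
  ∈-preimage⁻ {S′} = ∈-subsetOf⁻ (preimage? S′)

  ∉-preimage⁺ : ∀ {S′ x} → h x ∉ S′ → x ∉ preimage S′
  ∉-preimage⁺ hx∉ = hx∉ ∘ proj₂ ∘ ∈-preimage⁻

  ∉-preimage⁻ : ∀ {S′ x} → x ≢ s → x ∉ preimage S′ → h x ∉ S′
  ∉-preimage⁻ x≢s x∉ = x∉ ∘ ∈-preimage⁺ x≢s

  s∉preimage : ∀ {S′} → s ∉ preimage S′
  s∉preimage s∈ = proj₁ (∈-preimage⁻ s∈) refl

  colouring : ∀ {K} → (Fin M → Fin K) → Fin M → Fin N → Fin K
  colouring c′ e = c′ ∘ collapse e

  -- How a step of G between s and its neighbour b is simulated in H once s is sent to σ.
  Bridge : (Fin M → Fin M → Set) → Subset M → Fin M → Fin N → Set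
  Bridge R′ S′ σ b = σ ≡ h b ⊎ (R′ σ (h b) × R′ (h b) σ × σ ∉ S′)

module Subdivision {N M : ℕ} {G : Graph N} {H : Graph M} {s t p : Fin N} {h : Fin N → Fin M}
                   (D : IsEdgeSubdivision G H s t p h) where
  open IsEdgeSubdivision D
  open Collapse s h

  t≢s : t ≢ s
  t≢s refl = adj-irrefl G s-adj-t

  p≢s : p ≢ s
  p≢s refl = adj-irrefl G s-adj-p

  t≢p : t ≢ p
  t≢p refl = adj-irrefl H h-adj-tp

  Ends : Fin N → Fin N → Set
  Ends x y = (x ≡ t × y ≡ p) ⊎ (x ≡ p × y ≡ t)

  ends? : ∀ x y → Dec (Ends x y)
  ends? x y = (x ≟ t ×-dec y ≟ p) ⊎-dec (x ≟ p ×-dec y ≟ t)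

  h-adj⁻-¬ends : ∀ {x y} → x ≢ s → y ≢ s → ¬ Ends x y → Adj H (h x) (h y) → Adj G x y
  h-adj⁻-¬ends x≢s y≢s ¬ends hxy with h-adj⁻ x≢s y≢s hxy
  ... | inj₁ xy   = xy
  ... | inj₂ ends = ⊥-elim (¬ends ends)

  h-adj-avoids-tp : ∀ {a b} → a ≢ s → b ≢ s → Adj G a b → DelEdge H (h t) (h p) (h a) (h b)
  h-adj-avoids-tp a≢s b≢s ab =
    h-adj a≢s b≢s ab ,
    (λ (ha≡ht , hb≡hp) → t-nonadj-p
       (subst₂ (Adj G) (h-injective a≢s t≢s ha≡ht) (h-injective b≢s p≢s hb≡hp) ab)) ,
    (λ (ha≡hp , hb≡ht) → t-nonadj-p
       (subst₂ (Adj G) (h-injective b≢s t≢s hb≡ht) (h-injective a≢s p≢s ha≡hp) (adj-sym G ab)))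

  h-delEdge : ∀ {x y a b} → x ≢ s → y ≢ s → a ≢ s → b ≢ s →
              DelEdge G x y a b → DelEdge H (h x) (h y) (h a) (h b)
  h-delEdge x≢s y≢s a≢s b≢s (ab , ¬xy , ¬yx) =
    h-adj a≢s b≢s ab ,
    (λ (ha≡hx , hb≡hy) → ¬xy (h-injective a≢s x≢s ha≡hx , h-injective b≢s y≢s hb≡hy)) ,
    (λ (ha≡hy , hb≡hx) → ¬yx (h-injective a≢s y≢s ha≡hy , h-injective b≢s x≢s hb≡hx))

  tp-survives : ∀ {x y} → x ≢ s → y ≢ s → ¬ Ends x y → DelEdge H (h x) (h y) (h t) (h p)
  tp-survives x≢s y≢s ¬ends =
    h-adj-tp ,
    (λ (ht≡hx , hp≡hy) →
       ¬ends (inj₁ (sym (h-injective t≢s x≢s ht≡hx) , sym (h-injective p≢s y≢s hp≡hy)))) ,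
    (λ (ht≡hy , hp≡hx) →
       ¬ends (inj₂ (sym (h-injective p≢s x≢s hp≡hx) , sym (h-injective t≢s y≢s ht≡hy))))

  collapse-injective : ∀ σ {x y} → x ≢ s → y ≢ s → collapse σ x ≡ collapse σ y → x ≡ y
  collapse-injective σ x≢s y≢s eq =
    h-injective x≢s y≢s (trans (sym (collapse-≢s σ x≢s)) (trans eq (collapse-≢s σ y≢s)))

  collapse-walk : ∀ {R : Fin N → Fin N → Set} {R′ : Fin M → Fin M → Set} {S′ σ} →
    (∀ {a b} → R a b → Adj G a b) → (∀ {a b} → a ≢ s → b ≢ s → R a b → R′ (h a) (h b)) →
    (∀ {b} → R s b ⊎ R b s → b ∉ preimage S′ → Bridge R′ S′ σ b) →
    ∀ {x y} → x ∉ preimage S′ → Reach R (preimage S′) x y → Reach R′ S′ (collapse σ x) (collapse σ y)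
  collapse-walk {R = R} {R′} {S′} {σ} R⊆G h-R bridge = reach-simulate (collapse σ) sim
    where
    sim : ∀ {a b} → a ∉ preimage S′ → R a b → b ∉ preimage S′ → SimulatedStep R′ S′ (collapse σ) a b
    sim {a} {b} a∉ r b∉ with a ≟ s | b ≟ s
    ... | yes refl | yes refl = ⊥-elim (adj-irrefl G (R⊆G r))
    ... | yes refl | no b≢s with bridge (inj₁ r) b∉
    ...   | inj₁ σ≡hb           = inj₁ σ≡hb
    ...   | inj₂ (σ-hb , _ , _) = inj₂ (σ-hb , ∉-preimage⁻ b≢s b∉)
    sim {a} {b} a∉ r b∉ | no a≢s | yes refl with bridge (inj₂ r) a∉
    ...   | inj₁ σ≡ha              = inj₁ (sym σ≡ha)
    ...   | inj₂ (_ , ha-σ , σ∉) = inj₂ (ha-σ , σ∉)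
    sim {a} {b} a∉ r b∉ | no a≢s | no b≢s =
      inj₂ (h-R a≢s b≢s r , ∉-preimage⁻ b≢s b∉)

  bridge-end : ∀ {R′ : Fin M → Fin M → Set} {S′ q b} → R′ (h t) (h p) → R′ (h p) (h t) →
               q ≡ t ⊎ q ≡ p → h q ∉ S′ → Adj G s b → Bridge R′ S′ (h q) b
  bridge-end tp pt q-end hq∉ sb with q-end | s-neighbours sb
  ... | inj₁ refl | inj₁ refl = inj₁ refl
  ... | inj₂ refl | inj₂ refl = inj₁ refl
  ... | inj₁ refl | inj₂ refl = inj₂ (tp , pt , hq∉)
  ... | inj₂ refl | inj₁ refl = inj₂ (pt , tp , hq∉)

  -- If both ends lie in S′, no walk avoiding preimage S′ can enter s, so any σ will do.
  bridge-point : ∀ {R′ : Fin M → Fin M → Set} → R′ (h t) (h p) → R′ (h p) (h t) → ∀ S′ →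
                 ∃ λ σ → ∀ {b} → Adj G s b → b ∉ preimage S′ → Bridge R′ S′ σ b
  bridge-point {R′} tp pt S′ with h t ∈? S′ | h p ∈? S′
  ... | no ht∉  | _       = h t , λ sb _ → bridge-end {R′} tp pt (inj₁ refl) ht∉ sb
  ... | yes _   | no hp∉  = h p , λ sb _ → bridge-end {R′} tp pt (inj₂ refl) hp∉ sb
  ... | yes ht∈ | yes hp∈ = h t , λ sb b∉ → ⊥-elim (b∉ (end∈ (s-neighbours sb)))
    where
    end∈ : ∀ {b} → b ≡ t ⊎ b ≡ p → b ∈ preimage S′
    end∈ (inj₁ refl) = ∈-preimage⁺ t≢s ht∈
    end∈ (inj₂ refl) = ∈-preimage⁺ p≢s hp∈

  walk-image : ∀ {R : Fin N → Fin N → Set} {R′ : Fin M → Fin M → Set} {S′ x y} →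
    (∀ {a b} → R a b → Adj G a b) → (∀ {a b} → a ≢ s → b ≢ s → R a b → R′ (h a) (h b)) →
    R′ (h t) (h p) → R′ (h p) (h t) →
    x ≢ s → y ≢ s → x ∉ preimage S′ → Reach R (preimage S′) x y → Reach R′ S′ (h x) (h y)
  walk-image {R′ = R′} {S′} R⊆G h-R tp pt x≢s y≢s x∉ w with bridge-point {R′} tp pt S′
  ... | σ , bridge =
    subst₂ (Reach R′ S′) (collapse-≢s σ x≢s) (collapse-≢s σ y≢s)
      (collapse-walk R⊆G h-R (λ r → bridge (Sum.[ R⊆G , adj-sym G ∘ R⊆G ] r)) x∉ w)

  end≢s : ∀ {q} → q ≡ t ⊎ q ≡ p → q ≢ s
  end≢s (inj₁ refl) = t≢s
  end≢s (inj₂ refl) = p≢s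

  s-nonadj : ∀ {y} → y ≢ t → y ≢ p → ¬ Adj G s y
  s-nonadj y≢t y≢p sy = Sum.[ y≢t , y≢p ] (s-neighbours sy)

  module _ {K : ℕ} (c′ : Fin M → Fin K) (e : Fin M) where

    rainbow-off-s : ∀ {T T′} → (∀ {a} → a ∈ T → a ≢ s × h a ∈ T′) →
                    Rainbow c′ T′ → Rainbow (colouring c′ e) T
    rainbow-off-s {T′ = T′} into = rainbow-pullback c′ (collapse e)
      (λ a∈ → subst (_∈ T′) (sym (collapse-≢s e (proj₁ (into a∈)))) (proj₂ (into a∈)))
      (λ a∈ b∈ → collapse-injective e (proj₁ (into a∈)) (proj₁ (into b∈)))

    rainbow-preimage : ∀ {S′} → Rainbow c′ S′ → Rainbow (colouring c′ e) (preimage S′)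
    rainbow-preimage = rainbow-off-s ∈-preimage⁻

    rainbow-preimage-∪ : ∀ {S′ x} → x ≢ s → Rainbow c′ (S′ ∪ ⁅ h x ⁆) →
                         Rainbow (colouring c′ e) (preimage S′ ∪ ⁅ x ⁆)
    rainbow-preimage-∪ {S′} {x} x≢s = rainbow-off-s into
      where
      into : ∀ {a} → a ∈ preimage S′ ∪ ⁅ x ⁆ → a ≢ s × h a ∈ S′ ∪ ⁅ h x ⁆
      into a∈ with x∈p∪q⁻ (preimage S′) ⁅ x ⁆ a∈
      ... | inj₁ a∈S′ = proj₁ (∈-preimage⁻ a∈S′) , x∈p∪q⁺ (inj₁ (proj₂ (∈-preimage⁻ a∈S′)))
      ... | inj₂ a∈x rewrite x∈⁅y⁆⇒x≡y x a∈x = x≢s , x∈p∪q⁺ (inj₂ (x∈⁅x⁆ (h x)))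

    rainbow-preimage-s : ∀ {X} → e ∉ X → Rainbow c′ (X ∪ ⁅ e ⁆) →
                         Rainbow (colouring c′ e) (preimage X ∪ ⁅ s ⁆)
    rainbow-preimage-s {X} e∉ = rainbow-pullback c′ (collapse e) into injective
      where
      view : ∀ {a} → a ∈ preimage X ∪ ⁅ s ⁆ → a ≡ s ⊎ (a ≢ s × h a ∈ X)
      view {a} a∈ = Sum.map (x∈⁅y⁆⇒x≡y s) ∈-preimage⁻ (Sum.swap (x∈p∪q⁻ (preimage X) ⁅ s ⁆ a∈))
      into : ∀ {a} → a ∈ preimage X ∪ ⁅ s ⁆ → collapse e a ∈ X ∪ ⁅ e ⁆
      into a∈ with view a∈
      ... | inj₁ refl = subst (_∈ X ∪ ⁅ e ⁆) (sym (collapse-s e)) (x∈p∪q⁺ (inj₂ (x∈⁅x⁆ e)))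
      ... | inj₂ (a≢s , ha∈) = subst (_∈ X ∪ ⁅ e ⁆) (sym (collapse-≢s e a≢s)) (x∈p∪q⁺ (inj₁ ha∈))
      injective : ∀ {a b} → a ∈ preimage X ∪ ⁅ s ⁆ → b ∈ preimage X ∪ ⁅ s ⁆ →
                  collapse e a ≡ collapse e b → a ≡ b
      injective a∈ b∈ eq with view a∈ | view b∈
      ... | inj₁ refl | inj₁ refl = refl
      ... | inj₁ refl | inj₂ (b≢s , hb∈) =
        ⊥-elim (e∉ (subst (_∈ X) (trans (sym (collapse-≢s e b≢s)) (trans (sym eq) (collapse-s e))) hb∈))
      ... | inj₂ (a≢s , ha∈) | inj₁ refl =
        ⊥-elim (e∉ (subst (_∈ X) (trans (sym (collapse-≢s e a≢s)) (trans eq (collapse-s e))) ha∈))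
      ... | inj₂ (a≢s , _) | inj₂ (b≢s , _) = collapse-injective e a≢s b≢s eq

    cut-off-s : IsRVDColoring H c′ → ∀ {x y} → x ≢ s → y ≢ s → ¬ Ends x y → x ≢ y →
                ∃ (RainbowVertexCut G (colouring c′ e) x y)
    cut-off-s rvd′ {x} {y} x≢s y≢s ¬ends x≢y with rvd′ (h x) (h y) (x≢y ∘ h-injective x≢s y≢s)
    ... | S′ , (hx∉ , hy∉ , sep , sep-adj) , rb , rb-adj =
      preimage S′ ,
      (x∉ , ∉-preimage⁺ hy∉ ,
       (λ ¬xy w → sep (¬xy ∘ h-adj⁻-¬ends x≢s y≢s ¬ends)
                      (walk-image (λ r → r) h-adj h-adj-tp (adj-sym H h-adj-tp) x≢s y≢s x∉ w)) ,
       (λ xy w → sep-adj (h-adj x≢s y≢s xy)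
                         (walk-image proj₁ (h-delEdge x≢s y≢s) tp (delEdge-sym H tp) x≢s y≢s x∉ w))) ,
      (λ ¬xy → rainbow-preimage (rb (¬xy ∘ h-adj⁻-¬ends x≢s y≢s ¬ends))) ,
      (λ xy → Sum.map (rainbow-preimage-∪ x≢s) (rainbow-preimage-∪ y≢s) (rb-adj (h-adj x≢s y≢s xy)))
      where
      x∉ : x ∉ preimage S′
      x∉ = ∉-preimage⁺ hx∉
      tp : DelEdge H (h x) (h y) (h t) (h p)
      tp = tp-survives x≢s y≢s ¬ends

    cut-t-p : ∀ {X} → VertexCut H (h t) (h p) X → e ∉ X → Rainbow c′ (X ∪ ⁅ e ⁆) →
              ∃ (RainbowVertexCut G (colouring c′ e) t p)
    cut-t-p {X} (ht∉ , hp∉ , _ , sep-adj) e∉ rb =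
      preimage X ∪ ⁅ s ⁆ ,
      (∉-cut t≢s ht∉ , ∉-cut p≢s hp∉ ,
       (λ _ w → sep-adj h-adj-tp (reach-simulate h sim (∉-cut t≢s ht∉) w)) , ⊥-elim ∘ t-nonadj-p) ,
      (λ _ → rainbow-preimage-s e∉ rb) , ⊥-elim ∘ t-nonadj-p
      where
      ∉-cut : ∀ {x} → x ≢ s → h x ∉ X → x ∉ preimage X ∪ ⁅ s ⁆
      ∉-cut x≢s hx∉ x∈ with x∈p∪q⁻ (preimage X) ⁅ s ⁆ x∈
      ... | inj₁ x∈X = ∉-preimage⁺ hx∉ x∈X
      ... | inj₂ x∈s = x≢s (x∈⁅y⁆⇒x≡y s x∈s)
      ≢s : ∀ {a} → a ∉ preimage X ∪ ⁅ s ⁆ → a ≢ s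
      ≢s a∉ refl = ∉-∪⁻ʳ a∉ (x∈⁅x⁆ s)
      sim : ∀ {a b} → a ∉ preimage X ∪ ⁅ s ⁆ → Adj G a b → b ∉ preimage X ∪ ⁅ s ⁆ →
            SimulatedStep (DelEdge H (h t) (h p)) X h a b
      sim a∉ ab b∉ = inj₂ (h-adj-avoids-tp (≢s a∉) (≢s b∉) ab , ∉-preimage⁻ (≢s b∉) (∉-∪⁻ˡ b∉))

    cut-s-t : ∀ {X} → VertexCut H (h t) (h p) X → e ∉ X → Rainbow c′ (X ∪ ⁅ e ⁆) →
              ∃ (RainbowVertexCut G (colouring c′ e) s t)
    cut-s-t {X} (ht∉ , hp∉ , _ , sep-adj) e∉ rb =
      preimage X ,
      (s∉preimage , ∉-preimage⁺ ht∉ , (λ ¬st → ⊥-elim (¬st s-adj-t)) ,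
       (λ _ w → sep-adj h-adj-tp (reach-reverse (delEdge-sym H) hp∉
          (subst₂ (Reach (DelEdge H (h t) (h p)) X) (collapse-s (h p)) (collapse-≢s (h p) t≢s)
            (collapse-walk proj₁ (λ a≢s b≢s → h-adj-avoids-tp a≢s b≢s ∘ proj₁) bridge s∉preimage w))))) ,
      (λ ¬st → ⊥-elim (¬st s-adj-t)) , (λ _ → inj₁ (rainbow-preimage-s e∉ rb))
      where
      bridge : ∀ {b} → DelEdge G s t s b ⊎ DelEdge G s t b s → b ∉ preimage X →
               Bridge (DelEdge H (h t) (h p)) X (h p) b
      bridge (inj₁ (sb , ¬st , _)) _ with s-neighbours sb
      ... | inj₁ refl = ⊥-elim (¬st (refl , refl))
      ... | inj₂ refl = inj₁ refl
      bridge (inj₂ (bs , _ , ¬ts)) _ with s-neighbours (adj-sym G bs)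
      ... | inj₁ refl = ⊥-elim (¬ts (refl , refl))
      ... | inj₂ refl = inj₁ refl

    cut-s-neighbours : c′ (h t) ≢ c′ (h p) → ∀ {y} → y ≢ s → y ≢ t → y ≢ p →
                       ∃ (RainbowVertexCut G (colouring c′ e) s y)
    cut-s-neighbours ct≢cp {y} y≢s y≢t y≢p =
      ⁅ t ⁆ ∪ ⁅ p ⁆ ,
      (Sum.[ t≢s ∘ sym , p≢s ∘ sym ] ∘ ∈-⁅⁆∪⁅⁆⁻ , Sum.[ y≢t , y≢p ] ∘ ∈-⁅⁆∪⁅⁆⁻ ,
       (λ _ w → y≢s (reach-invariant (_≡ s) leaves-s refl w)) , ⊥-elim ∘ s-nonadj y≢t y≢p) ,
      (λ _ → rainbow-pair (colouring c′ e)
               (ct≢cp ∘ subst₂ (λ a b → c′ a ≡ c′ b) (collapse-≢s e t≢s) (collapse-≢s e p≢s))) ,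
      ⊥-elim ∘ s-nonadj y≢t y≢p
      where
      leaves-s : ∀ {a b} → a ≡ s → Adj G a b → b ∉ ⁅ t ⁆ ∪ ⁅ p ⁆ → b ≡ s
      leaves-s refl sb b∉ = ⊥-elim (b∉ (∈-⁅⁆∪⁅⁆⁺ (s-neighbours sb)))

    cut-s-via : IsRVDColoring H c′ → ∀ {q y} → q ≡ t ⊎ q ≡ p → y ≢ s → y ≢ t → y ≢ p → ¬ Adj G q y →
                ∃ (RainbowVertexCut G (colouring c′ e) s y)
    cut-s-via rvd′ {q} {y} q-end y≢s y≢t y≢p ¬qy
      with rvd′ (h q) (h y) (Sum.[ (λ { refl → y≢t ∘ sym }) , (λ { refl → y≢p ∘ sym }) ] q-end ∘
                             h-injective (end≢s q-end) y≢s)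
    ... | Y , (hq∉ , hy∉ , sep , _) , rb , _ =
      preimage Y ,
      (s∉preimage , ∉-preimage⁺ hy∉ ,
       (λ _ w → sep ¬hq-hy (subst₂ (Reach (Adj H) Y) (collapse-s (h q)) (collapse-≢s (h q) y≢s)
                  (collapse-walk (λ r → r) h-adj bridge s∉preimage w))) ,
       ⊥-elim ∘ s-nonadj y≢t y≢p) ,
      (λ _ → rainbow-preimage (rb ¬hq-hy)) , ⊥-elim ∘ s-nonadj y≢t y≢p
      where
      ¬hq-hy : ¬ Adj H (h q) (h y)
      ¬hq-hy = ¬qy ∘ h-adj⁻-¬ends (end≢s q-end) y≢s Sum.[ y≢p ∘ proj₂ , y≢t ∘ proj₂ ]
      bridge : ∀ {b} → Adj G s b ⊎ Adj G b s → b ∉ preimage Y → Bridge (Adj H) Y (h q) b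
      bridge r _ = bridge-end {Adj H} h-adj-tp (adj-sym H h-adj-tp) q-end hq∉ (Sum.[ (λ sb → sb) , adj-sym G ] r)

    cut-s-far : IsRVDColoring H c′ → (∀ y → y ≢ s → Adj G t y → Adj G p y → c′ (h t) ≢ c′ (h p)) →
                ∀ {y} → y ≢ s → y ≢ t → y ≢ p → ∃ (RainbowVertexCut G (colouring c′ e) s y)
    cut-s-far rvd′ common-neighbour {y} y≢s y≢t y≢p with adj? G t y | adj? G p y
    ... | yes ty | yes py = cut-s-neighbours (common-neighbour y y≢s ty py) y≢s y≢t y≢p
    ... | no ¬ty | _      = cut-s-via rvd′ (inj₁ refl) y≢s y≢t y≢p ¬ty
    ... | yes _  | no ¬py = cut-s-via rvd′ (inj₂ refl) y≢s y≢t y≢p ¬py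

module _ {N M K : ℕ} {G : Graph N} {H : Graph M} {s t p : Fin N} {h : Fin N → Fin M}
         (D : IsEdgeSubdivision G H s t p h) (c′ : Fin M → Fin K) (rvd′ : IsRVDColoring H c′)
         (common-neighbour : ∀ y → y ≢ s → Adj G t y → Adj G p y → c′ (h t) ≢ c′ (h p)) where
  open IsEdgeSubdivision D
  open Collapse s h
  open Subdivision D
  private module Swapped = Subdivision (isEdgeSubdivision-swap D)

  module _ {X : Subset M} {e : Fin M} (cut : VertexCut H (h t) (h p) X) (e∉ : e ∉ X)
           (rb : Rainbow c′ (X ∪ ⁅ e ⁆)) where

    reverse-cut : ∀ {x y} → ∃ (RainbowVertexCut G (colouring c′ e) x y) →
                  ∃ (RainbowVertexCut G (colouring c′ e) y x)
    reverse-cut (S , rvc) = S , rainbowVertexCut-sym G rvc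

    cut-from-s : ∀ {y} → y ≢ s → ∃ (RainbowVertexCut G (colouring c′ e) s y)
    cut-from-s {y} y≢s with y ≟ t | y ≟ p
    ... | yes refl | _        = cut-s-t c′ e cut e∉ rb
    ... | no _     | yes refl = Swapped.cut-s-t c′ e (vertexCut-sym H cut) e∉ rb
    ... | no y≢t   | no y≢p   = cut-s-far c′ e rvd′ common-neighbour y≢s y≢t y≢p

    subdivision-colouring : IsRVDColoring G (colouring c′ e)
    subdivision-colouring x y x≢y with x ≟ s | y ≟ s
    ... | yes refl | _        = cut-from-s (x≢y ∘ sym)
    ... | no x≢s   | yes refl = reverse-cut (cut-from-s x≢s)
    ... | no x≢s   | no y≢s with ends? x y
    ...   | yes (inj₁ (refl , refl)) = cut-t-p c′ e cut e∉ rb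
    ...   | yes (inj₂ (refl , refl)) = reverse-cut (cut-t-p c′ e cut e∉ rb)
    ...   | no ¬ends                 = cut-off-s c′ e rvd′ x≢s y≢s ¬ends x≢y

  subdivision-hasRVD : HasRVD G K
  subdivision-hasRVD with rvd′ (h t) (h p) (t≢p ∘ h-injective t≢s p≢s)
  ... | X , cut@(ht∉ , hp∉ , _) , _ , rb-adj with rb-adj h-adj-tp
  ...   | inj₁ rb = colouring c′ (h t) , subdivision-colouring cut ht∉ rb
  ...   | inj₂ rb = colouring c′ (h p) , subdivision-colouring cut hp∉ rb

module Contraction {m : ℕ} (G : Graph (suc m)) {u v : Fin (suc m)} (uv : Adj G u v) where

  G/uv : Graph m
  G/uv = contract G u v

  v≢u : v ≢ u
  v≢u refl = adj-irrefl G uv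

  -- u and v both go to the merged vertex, which G/uv represents by u.
  π : Fin (suc m) → Fin m
  π x with v ≟ x
  ... | yes _   = punchOut v≢u
  ... | no  v≢x = punchOut v≢x

  punchIn-π : ∀ {x} → x ≢ v → punchIn v (π x) ≡ x
  punchIn-π {x} x≢v with v ≟ x
  ... | yes v≡x = ⊥-elim (x≢v (sym v≡x))
  ... | no  v≢x = punchIn-punchOut v≢x

  punchIn-π-v : punchIn v (π v) ≡ u
  punchIn-π-v with v ≟ v
  ... | yes _   = punchIn-punchOut v≢u
  ... | no  v≢v = ⊥-elim (v≢v refl)

  π-punchIn : ∀ a → π (punchIn v a) ≡ a
  π-punchIn a with v ≟ punchIn v a
  ... | yes v≡ = ⊥-elim (punchInᵢ≢i v a (sym v≡))
  ... | no  _  = trans (punchOut-cong v refl) (punchOut-punchIn v)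

  π-u≡π-v : π u ≡ π v
  π-u≡π-v = punchIn-injective v _ _ (trans (punchIn-π (v≢u ∘ sym)) (sym punchIn-π-v))

  π-fibre : ∀ {x y} → π x ≡ π y → x ≡ y ⊎ ((x ≡ u ⊎ x ≡ v) × (y ≡ u ⊎ y ≡ v))
  π-fibre {x} {y} πx≡πy with x ≟ v | y ≟ v
  ... | yes refl | yes refl = inj₁ refl
  ... | yes refl | no y≢v   =
    inj₂ (inj₂ refl , inj₁ (trans (sym (punchIn-π y≢v)) (trans (cong (punchIn v) (sym πx≡πy)) punchIn-π-v)))
  ... | no x≢v   | yes refl =
    inj₂ (inj₁ (trans (sym (punchIn-π x≢v)) (trans (cong (punchIn v) πx≡πy) punchIn-π-v)) , inj₂ refl)
  ... | no x≢v   | no y≢v   =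
    inj₁ (trans (sym (punchIn-π x≢v)) (trans (cong (punchIn v) πx≡πy) (punchIn-π y≢v)))

  contract-adj⁺ : ∀ {x y} → Adj G x y → π x ≢ π y → Adj G/uv (π x) (π y)
  contract-adj⁺ {x} {y} xy πx≢πy with x ≟ v | y ≟ v
  ... | yes refl | yes refl = ⊥-elim (adj-irrefl G xy)
  ... | yes refl | no y≢v   =
    πx≢πy , inj₂ (inj₁ (punchIn-π-v , subst (Adj G v) (sym (punchIn-π y≢v)) xy))
  ... | no x≢v   | yes refl =
    πx≢πy , inj₂ (inj₂ (punchIn-π-v , subst (λ a → Adj G a v) (sym (punchIn-π x≢v)) xy))
  ... | no x≢v   | no y≢v   =
    πx≢πy , inj₁ (subst₂ (Adj G) (sym (punchIn-π x≢v)) (sym (punchIn-π y≢v)) xy)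

  π-v≡ : ∀ {a} → punchIn v a ≡ u → π v ≡ a
  π-v≡ {a} a≡u = trans (sym π-u≡π-v) (trans (cong π (sym a≡u)) (π-punchIn a))

  contract-adj⁻ : ∀ {a b} → Adj G/uv a b → ∃₂ λ x y → π x ≡ a × π y ≡ b × Adj G x y
  contract-adj⁻ {a} {b} (_ , inj₁ ab)                = punchIn v a , punchIn v b , π-punchIn a , π-punchIn b , ab
  contract-adj⁻ {a} {b} (_ , inj₂ (inj₁ (a≡u , vb))) = v , punchIn v b , π-v≡ a≡u , π-punchIn b , vb
  contract-adj⁻ {a} {b} (_ , inj₂ (inj₂ (b≡u , av))) = punchIn v a , v , π-punchIn a , π-v≡ b≡u , av

  π-adj-distinct : ∀ {x y} → Adj G/uv (π x) (π y) → x ≢ y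
  π-adj-distinct πxy refl = adj-irrefl G/uv πxy

  OrientedAs : Fin (suc m) → Fin (suc m) → Set
  OrientedAs s t = (s ≡ u × t ≡ v) ⊎ (s ≡ v × t ≡ u)

  oriented-end : ∀ {s t x} → OrientedAs s t → x ≡ u ⊎ x ≡ v → x ≡ s ⊎ x ≡ t
  oriented-end (inj₁ (refl , refl)) = λ x-end → x-end
  oriented-end (inj₂ (refl , refl)) = Sum.swap

  oriented-adj : ∀ {s t} → OrientedAs s t → Adj G s t
  oriented-adj (inj₁ (refl , refl)) = uv
  oriented-adj (inj₂ (refl , refl)) = adj-sym G uv

  oriented-π : ∀ {s t} → OrientedAs s t → π s ≡ π t
  oriented-π (inj₁ (refl , refl)) = π-u≡π-v
  oriented-π (inj₂ (refl , refl)) = sym π-u≡π-v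

  module _ {s t p : Fin (suc m)} (s-t : OrientedAs s t)
           (s-neighbours : ∀ {y} → Adj G s y → y ≡ t ⊎ y ≡ p) (sp : Adj G s p)
           (p≢t : p ≢ t) (¬tp : ¬ Adj G t p) where

    π-representative : ∀ {x₀ x} → x ≢ s → π x₀ ≡ π x → x₀ ≡ x ⊎ (x₀ ≡ s × x ≡ t)
    π-representative x≢s πx₀≡πx with π-fibre πx₀≡πx
    ... | inj₁ x₀≡x = inj₁ x₀≡x
    ... | inj₂ (x₀-end , x-end) with oriented-end s-t x₀-end | oriented-end s-t x-end
    ...   | _           | inj₁ x≡s = ⊥-elim (x≢s x≡s)
    ...   | inj₁ x₀≡s   | inj₂ x≡t = inj₂ (x₀≡s , x≡t)
    ...   | inj₂ x₀≡t   | inj₂ x≡t = inj₁ (trans x₀≡t (sym x≡t))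

    π-injective : ∀ {x y} → x ≢ s → y ≢ s → π x ≡ π y → x ≡ y
    π-injective x≢s y≢s πx≡πy with π-representative y≢s πx≡πy
    ... | inj₁ x≡y       = x≡y
    ... | inj₂ (x≡s , _) = ⊥-elim (x≢s x≡s)

    π-adj⁻ : ∀ {x y} → x ≢ s → y ≢ s → Adj G/uv (π x) (π y) →
             Adj G x y ⊎ (x ≡ t × y ≡ p) ⊎ (x ≡ p × y ≡ t)
    π-adj⁻ {x} {y} x≢s y≢s πxy with contract-adj⁻ πxy
    ... | x₀ , y₀ , πx₀ , πy₀ , x₀y₀ with π-representative x≢s πx₀ | π-representative y≢s πy₀
    ...   | inj₁ refl          | inj₁ refl          = inj₁ x₀y₀
    ...   | inj₂ (refl , x≡t)  | inj₂ (refl , _)    = ⊥-elim (adj-irrefl G x₀y₀)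
    ...   | inj₂ (refl , x≡t)  | inj₁ refl with s-neighbours x₀y₀
    ...     | inj₁ y≡t = ⊥-elim (π-adj-distinct πxy (trans x≡t (sym y≡t)))
    ...     | inj₂ y≡p = inj₂ (inj₁ (x≡t , y≡p))
    π-adj⁻ {x} {y} x≢s y≢s πxy | x₀ , y₀ , πx₀ , πy₀ , x₀y₀ | inj₁ refl | inj₂ (refl , y≡t)
      with s-neighbours (adj-sym G x₀y₀)
    ...     | inj₁ x≡t = ⊥-elim (π-adj-distinct πxy (trans x≡t (sym y≡t)))
    ...     | inj₂ x≡p = inj₂ (inj₂ (x≡p , y≡t))

    contraction-subdivision : IsEdgeSubdivision G G/uv s t p π
    contraction-subdivision = record
      { h-injective  = π-injective
      ; s-adj-t      = oriented-adj s-t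
      ; s-adj-p      = sp
      ; s-neighbours = s-neighbours
      ; t-nonadj-p   = ¬tp
      ; h-adj        = λ x≢s y≢s xy → contract-adj⁺ xy (λ πx≡πy →
                         adj-irrefl G (subst (Adj G _) (sym (π-injective x≢s y≢s πx≡πy)) xy))
      ; h-adj⁻       = π-adj⁻
      ; h-adj-tp     = subst (λ a → Adj G/uv a (π p)) (oriented-π s-t) (contract-adj⁺ sp π-s≢π-p)
      }
      where
      π-s≢π-p : π s ≢ π p
      π-s≢π-p πs≡πp with π-representative (λ { refl → adj-irrefl G sp }) πs≡πp
      ... | inj₁ refl      = adj-irrefl G sp
      ... | inj₂ (_ , p≡t) = p≢t p≡t

  module _ {w z : Fin (suc m)} (uw : Adj G u w) (vz : Adj G v z) (w≢v : w ≢ v) (z≢u : z ≢ u) (w≢z : w ≢ z)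
           (u-neighbours : ∀ {y} → Adj G u y → y ≡ v ⊎ y ≡ w)
           (v-neighbours : ∀ {y} → Adj G v y → y ≡ u ⊎ y ≡ z) where

    w≢u : w ≢ u
    w≢u refl = adj-irrefl G uw

    suppress-v : IsEdgeSubdivision G G/uv v u z π
    suppress-v = contraction-subdivision (inj₂ (refl , refl)) v-neighbours vz z≢u
                   (Sum.[ (λ { refl → adj-irrefl G vz }) , w≢z ∘ sym ] ∘ u-neighbours)

    suppress-u : IsEdgeSubdivision G G/uv u v w π
    suppress-u = contraction-subdivision (inj₁ (refl , refl)) u-neighbours uw w≢v
                   (Sum.[ w≢u , w≢z ] ∘ v-neighbours)

    contraction-hasRVD : ∀ {K} → HasRVD G/uv K → HasRVD G K
    contraction-hasRVD (c′ , rvd′) with c′ (π u) ≟ c′ (π z)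
    ... | no  cu≢cz = subdivision-hasRVD suppress-v c′ rvd′ (λ _ _ _ _ → cu≢cz)
    ... | yes cu≡cz = subdivision-hasRVD suppress-u c′ rvd′ no-triangle
      where
      open IsEdgeSubdivision suppress-u
      no-triangle : ∀ y → y ≢ u → Adj G v y → Adj G w y → c′ (π v) ≢ c′ (π w)
      no-triangle y y≢u vy wy cv≡cw with v-neighbours vy
      ... | inj₁ y≡u  = y≢u y≡u
      ... | inj₂ refl =
        rvd-no-monochromatic-triangle G/uv rvd′ h-adj-tp (h-adj w≢u z≢u wy) (h-adj v≢u z≢u vy)
          cv≡cw (trans (cong c′ (sym π-u≡π-v)) cu≡cz)

mainTheorem1 : ∀ {m} (G : Graph (suc m)) → 4 ≤ suc m → TwoConnected G →
    (u v : Fin (suc m)) → Adj G u v → degree G u ≡ 2 → degree G v ≡ 2 →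
    (r r' : ℕ) → RvdIs G r → RvdIs (contract G u v) r' → r ≤ r'
mainTheorem1 G 4≤n (_ , _ , no-cut-vertex) u v uv du dv r r′ (_ , minimal) (rvd′ , _)
  with degree-two-neighbours G uv du | degree-two-neighbours G (adj-sym G uv) dv
... | w , uw , w≢v , u-neighbours | z , vz , z≢u , v-neighbours =
  minimal r′ (Contraction.contraction-hasRVD G uv uw vz w≢v z≢u w≢z u-neighbours v-neighbours rvd′)
  where
  w≢z : w ≢ z
  w≢z = pendant-path-ends-distinct G 4≤n no-cut-vertex (λ { refl → adj-irrefl G uw }) u-neighbours v-neighbours
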